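{- For all integers $m,n\geq 3$, $\chi_\delta(S_{1,m}\square S_{1,n})=mn$.
   Context: All graphs are finite and simple; $S_{1,n}$ is the star with $n$ pendant vertices (one center adjacent to $n$ leaves); $d_G(x)$ denotes the degree of $x$ in $G$. The $\delta$-complement $G_\delta$ of a graph $G$ is the graph on $V(G)$ in which distinct $u,v$ are adjacent iff either ($d_G(u)=d_G(v)$ and $uv\notin E(G)$) or ($d_G(u)\neq d_G(v)$ and $uv\in E(G)$). The $\delta$-chromatic number $\chi_\delta(G)$ is the chromatic number of $G_\delta$. The Cartesian product $G\square H$ has vertex set $V(G)\times V(H)$, with $(x,y)$ adjacent to $(x',y')$ iff either $x=x'$ and $yy'\in E(H)$, or $y=y'$ and $xx'\in E(G)$. -}

module Defs where

open import Data.Nat using (ℕ; zero; suc; _+_; _*_; _<_; _≡ᵇ_)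
open import Data.Bool using (Bool; true; false; not; _∧_; _∨_; if_then_else_)
open import Data.Fin using (Fin; zero; suc; remQuot; _≟_)
open import Data.List using (List; map)
open import Data.Nat.ListAction using (sum)
open import Data.Product using (Σ; _×_; _,_)
open import Relation.Nullary using (¬_; does)
open import Relation.Binary.PropositionalEquality using (_≡_; _≢_)
import Data.List as L

-- A finite graph on the vertex set Fin order, given by a Boolean adjacency
-- relation.  All graphs constructed below are simple (symmetric, loopless).
record Graph : Set where
  field
    order : ℕ
    adj   : Fin order → Fin order → Bool
open Graph public

allFin : (n : ℕ) → List (Fin n)
allFin n = L.allFin n

deg : (G : Graph) → Fin (order G) → ℕ
deg G x = sum (map (λ y → if adj G x y then 1 else 0) (allFin (order G)))

_==_ : ∀ {n} → Fin n → Fin n → Bool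
x == y = does (x ≟ y)

starAdj : ∀ {n} → Fin (suc n) → Fin (suc n) → Bool
starAdj zero    zero    = false
starAdj zero    (suc _) = true
starAdj (suc _) zero    = true
starAdj (suc _) (suc _) = false

S1 : ℕ → Graph
S1 n = record { order = suc n ; adj = starAdj }

_□_ : Graph → Graph → Graph
G □ H = record
  { order = order G * order H
  ; adj   = λ p q → go (remQuot (order H) p) (remQuot (order H) q)
  }
  where
  go : Fin (order G) × Fin (order H) → Fin (order G) × Fin (order H) → Bool
  go (x , y) (x' , y') = ((x == x') ∧ adj H y y') ∨ ((y == y') ∧ adj G x x')

δ-complement : Graph → Graph
δ-complement G = record
  { order = order G
  ; adj   = λ u v → if u == v then false
                    else (if deg G u ≡ᵇ deg G v then not (adj G u v) else adj G u v)
  }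

ProperColouring : (G : Graph) (k : ℕ) → (Fin (order G) → Fin k) → Set
ProperColouring G k c = ∀ u v → adj G u v ≡ true → c u ≢ c v

Colourable : Graph → ℕ → Set
Colourable G k = Σ (Fin (order G) → Fin k) (ProperColouring G k)

ChromaticNumber : Graph → ℕ → Set
ChromaticNumber G k = Colourable G k × (∀ j → j < k → ¬ Colourable G j)

δChromaticNumber : Graph → ℕ → Set
δChromaticNumber G k = ChromaticNumber (δ-complement G) k

-- In S_{1,m} □ S_{1,n} the mn vertices (leaf, leaf) all have degree 2 and are pairwise
-- non-adjacent, so they form a clique of the δ-complement and at least mn colours are needed.
-- Every other vertex lies on one of the two "axes" (its first or second coordinate is a centre), and
-- has degree n + m, m + 1 or n + 1, never 2 when m, n ≥ 3.  Give the leaf–leaf vertices distinct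
-- colours and each axis vertex the colour of a leaf–leaf vertex not adjacent to it, injectively
-- (possible as m + n + 1 ≤ mn).  Two vertices of one colour then have different degrees and are
-- non-adjacent, hence are non-adjacent in the δ-complement.

module Submission where

open import Defs
open import Data.Nat using (ℕ; _≤_; _*_)
open import Data.Nat as ℕ using (zero; suc; _+_; _<_; _≡ᵇ_; s≤s)
open import Data.Nat.Properties using (+-0-commutativeMonoid; +-assoc; +-identityʳ; ≡ᵇ⇒≡; ≡⇒≡ᵇ)
import Data.Nat.ListAction as ListAction
open import Data.Bool using (Bool; true; false; not; _∧_; _∨_; if_then_else_)
open import Data.Bool.Properties using (¬-not; T-≡; ∧-zeroʳ)
open import Data.Fin as Fin using (Fin; zero; suc; remQuot; combine; _≟_; inject₁; fromℕ; _↑ˡ_; _↑ʳ_)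
open import Data.Fin.Properties
  using (remQuot-combine; combine-remQuot; combine-injective; suc-injective; inject₁-injective;
         fromℕ≢inject₁; pigeonhole; <⇒≢; ≤̄⇒inject₁<; ≤-refl)
import Data.List as List
open import Data.List.Properties using (map-tabulate)
open import Data.Product as Product using (_×_; _,_; proj₁; proj₂; uncurry)
open import Data.Product.Properties using (×-≡,≡→≡; ,-injectiveˡ; ,-injectiveʳ)
open import Data.Sum as Sum using (_⊎_; inj₁; inj₂)
open import Function using (_∘_; id; Equivalence)
open import Relation.Nullary using (¬_; yes; no; contradiction)
open import Relation.Nullary.Decidable using (dec-true; dec-false)
open import Relation.Binary.PropositionalEquality
open import Algebra.Properties.CommutativeMonoid.Sum +-0-commutativeMonoid
  using (sum; sum-syntax; sum-cong-≗; sum-replicate-zero; ∑-distrib-+; ∑-comm)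

inject₁≢suc : ∀ {k} (i : Fin k) → inject₁ i ≢ suc i
inject₁≢suc i = <⇒≢ (≤̄⇒inject₁< ≤-refl)

==-refl : ∀ {k} (x : Fin k) → (x == x) ≡ true
==-refl x = dec-true (x ≟ x) refl

==-sym : ∀ {k} (x y : Fin k) → (x == y) ≡ (y == x)
==-sym x y with x ≟ y | y ≟ x
... | yes _   | yes _   = refl
... | no  _   | no  _   = refl
... | yes x≡y | no  y≢x = contradiction (sym x≡y) y≢x
... | no  x≢y | yes y≡x = contradiction (sym y≡x) x≢y

==-false : ∀ {k} {x y : Fin k} → x ≢ y → (x == y) ≡ false
==-false {x = x} {y} = dec-false (x ≟ y)

≡ᵇ-true : ∀ {m n} → m ≡ n → (m ≡ᵇ n) ≡ true
≡ᵇ-true {m} {n} = Equivalence.to T-≡ ∘ ≡⇒≡ᵇ m n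

≡ᵇ-false : ∀ {m n} → m ≢ n → (m ≡ᵇ n) ≡ false
≡ᵇ-false {m} {n} m≢n = ¬-not (m≢n ∘ ≡ᵇ⇒≡ m n ∘ Equivalence.from T-≡)

remQuot-injective : ∀ {m} n {i j : Fin (m * n)} → remQuot {m} n i ≡ remQuot n j → i ≡ j
remQuot-injective {m} n {i} {j} e =
  trans (sym (combine-remQuot {m} n i)) (trans (cong (uncurry combine) e) (combine-remQuot {m} n j))

indicator : Bool → ℕ
indicator b = if b then 1 else 0

sum-tabulate : ∀ {k} (f : Fin k → ℕ) → ListAction.sum (List.tabulate f) ≡ sum f
sum-tabulate {zero}  f = refl
sum-tabulate {suc k} f = cong (f zero +_) (sum-tabulate (f ∘ suc))

∑-↑ : ∀ a {b} (f : Fin (a + b) → ℕ) → sum f ≡ ∑[ i < a ] f (i ↑ˡ b) + ∑[ j < b ] f (a ↑ʳ j)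
∑-↑ zero    f = refl
∑-↑ (suc a) f = trans (cong (f zero +_) (∑-↑ a (f ∘ suc))) (sym (+-assoc (f zero) _ _))

∑-combine : ∀ a {b} (f : Fin (a * b) → ℕ) → sum f ≡ ∑[ i < a ] ∑[ j < b ] f (combine i j)
∑-combine zero        f = refl
∑-combine (suc a) {b} f =
  trans (∑-↑ b f) (cong (∑[ j < b ] f (j ↑ˡ a * b) +_) (∑-combine a (f ∘ (b ↑ʳ_))))

∑-one : ∀ k → ∑[ i < k ] 1 ≡ k
∑-one zero    = refl
∑-one (suc k) = cong suc (∑-one k)

∑-indicator : ∀ {k} (i : Fin k) (c : ℕ) → ∑[ j < k ] (if i == j then c else 0) ≡ c
∑-indicator {suc k} zero    c = trans (cong (c +_) (sum-replicate-zero k)) (+-identityʳ c)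
∑-indicator {suc k} (suc i) c = ∑-indicator i c

Loopless : Graph → Set
Loopless G = ∀ x → adj G x x ≡ false

Undirected : Graph → Set
Undirected G = ∀ x y → adj G x y ≡ adj G y x

deg≡∑ : ∀ G x → deg G x ≡ ∑[ y < order G ] indicator (adj G x y)
deg≡∑ G x =
  trans (cong ListAction.sum (map-tabulate id (indicator ∘ adj G x))) (sum-tabulate (indicator ∘ adj G x))

□-adj : ∀ G H (x x' : Fin (order G)) (y y' : Fin (order H)) →
        adj (G □ H) (combine x y) (combine x' y') ≡ ((x == x') ∧ adj H y y') ∨ ((y == y') ∧ adj G x x')
□-adj G H x x' y y' = cong₂ adjPair (remQuot-combine x y) (remQuot-combine x' y')
  where
  adjPair : Fin (order G) × Fin (order H) → Fin (order G) × Fin (order H) → Bool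
  adjPair (x , y) (x' , y') = ((x == x') ∧ adj H y y') ∨ ((y == y') ∧ adj G x x')

□-undirected : ∀ G H → Undirected G → Undirected H → Undirected (G □ H)
□-undirected G H undirG undirH u v =
  cong₂ _∨_ (cong₂ _∧_ (==-sym x x') (undirH y y')) (cong₂ _∧_ (==-sym y y') (undirG x x'))
  where
  x  = proj₁ (remQuot {order G} (order H) u)
  y  = proj₂ (remQuot {order G} (order H) u)
  x' = proj₁ (remQuot {order G} (order H) v)
  y' = proj₂ (remQuot {order G} (order H) v)

-- An edge of G □ H moves in exactly one coordinate; looplessness of G keeps the two cases disjoint.
□-adj-indicator : ∀ G H → Loopless G → ∀ x x' y y' →
  indicator (adj (G □ H) (combine x y) (combine x' y'))
    ≡ (if x == x' then indicator (adj H y y') else 0) + (if y == y' then indicator (adj G x x') else 0)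
□-adj-indicator G H loopless x x' y y' rewrite □-adj G H x x' y y' with x ≟ x'
... | yes refl rewrite loopless x with adj H y y' | y == y'
...   | true  | true  = refl
...   | true  | false = refl
...   | false | true  = refl
...   | false | false = refl
□-adj-indicator G H loopless x x' y y' | no _ with y == y'
...   | true  = refl
...   | false = refl

deg-□ : ∀ G H → Loopless G → ∀ x y → deg (G □ H) (combine x y) ≡ deg H y + deg G x
deg-□ G H loopless x y = begin
  deg (G □ H) (combine x y)
    ≡⟨ deg≡∑ (G □ H) (combine x y) ⟩
  sum (indicator ∘ adj (G □ H) (combine x y))
    ≡⟨ ∑-combine (order G) _ ⟩
  ∑[ x' < order G ] ∑[ y' < order H ] indicator (adj (G □ H) (combine x y) (combine x' y'))
    ≡⟨ sum-cong-≗ (λ x' → sum-cong-≗ (□-adj-indicator G H loopless x x' y)) ⟩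
  ∑[ x' < order G ] ∑[ y' < order H ] (alongH x' y' + alongG x' y')
    ≡⟨ sum-cong-≗ (λ x' → ∑-distrib-+ (alongH x') (alongG x')) ⟩
  ∑[ x' < order G ] (∑[ y' < order H ] alongH x' y' + ∑[ y' < order H ] alongG x' y')
    ≡⟨ ∑-distrib-+ (λ x' → ∑[ y' < order H ] alongH x' y') (λ x' → ∑[ y' < order H ] alongG x' y') ⟩
  ∑[ x' < order G ] ∑[ y' < order H ] alongH x' y' + ∑[ x' < order G ] ∑[ y' < order H ] alongG x' y'
    ≡⟨ cong (_+ ∑[ x' < order G ] ∑[ y' < order H ] alongG x' y') (∑-comm alongH) ⟩
  ∑[ y' < order H ] ∑[ x' < order G ] alongH x' y' + ∑[ x' < order G ] ∑[ y' < order H ] alongG x' y'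
    ≡⟨ cong₂ _+_ (sum-cong-≗ (λ y' → ∑-indicator x (indicator (adj H y y'))))
                  (sum-cong-≗ (λ x' → ∑-indicator y (indicator (adj G x x')))) ⟩
  ∑[ y' < order H ] indicator (adj H y y') + ∑[ x' < order G ] indicator (adj G x x')
    ≡⟨ cong₂ _+_ (deg≡∑ H y) (deg≡∑ G x) ⟨
  deg H y + deg G x ∎
  where
  open ≡-Reasoning
  alongH alongG : Fin (order G) → Fin (order H) → ℕ
  alongH x' y' = if x == x' then indicator (adj H y y') else 0
  alongG x' y' = if y == y' then indicator (adj G x x') else 0

δ-complement-irreflexive : ∀ H u → adj (δ-complement H) u u ≡ false
δ-complement-irreflexive H u rewrite ==-refl u = refl

δ-complement-adj-≢deg : ∀ H {u v} → deg H u ≢ deg H v → adj (δ-complement H) u v ≡ adj H u v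
δ-complement-adj-≢deg H d rewrite ==-false (d ∘ cong (deg H)) | ≡ᵇ-false d = refl

δ-complement-adj-≡deg : ∀ H {u v} → u ≢ v → deg H u ≡ deg H v → adj (δ-complement H) u v ≡ not (adj H u v)
δ-complement-adj-≡deg H u≢v d rewrite ==-false u≢v | ≡ᵇ-true d = refl

clique⇒¬colourable : ∀ H {k} (f : Fin k → Fin (order H)) → (∀ {i j} → i ≢ j → adj H (f i) (f j) ≡ true) →
                     ∀ {j} → j < k → ¬ Colourable H j
clique⇒¬colourable H f clique j<k (c , proper) with pigeonhole j<k (c ∘ f)
... | i , i' , i<i' , same = proper (f i) (f i') (clique (<⇒≢ i<i')) same

Separated : (H : Graph) → Fin (order H) → Fin (order H) → Set
Separated H u v = deg H u ≢ deg H v × adj H u v ≡ false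

Separated-sym : ∀ H → Undirected H → ∀ {u v} → Separated H u v → Separated H v u
Separated-sym H undir {u} {v} (d , nonadj) = d ∘ sym , trans (undir v u) nonadj

δ-proper : ∀ H {k} (c : Fin (order H) → Fin k) → (∀ u v → c u ≡ c v → u ≡ v ⊎ Separated H u v) →
           ProperColouring (δ-complement H) k c
δ-proper H c shared u v δ-adjacent same with shared u v same
... | inj₁ refl = contradiction (trans (sym δ-adjacent) (δ-complement-irreflexive H u)) λ ()
... | inj₂ (d , nonadj) =
  contradiction (trans (sym δ-adjacent) (trans (δ-complement-adj-≢deg H d) nonadj)) λ ()

□-δ-colourable : ∀ G H {k} (κ : Fin (order G) × Fin (order H) → Fin k) →
  (∀ p q → κ p ≡ κ q → p ≡ q ⊎ Separated (G □ H) (uncurry combine p) (uncurry combine q)) →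
  Colourable (δ-complement (G □ H)) k
□-δ-colourable G H κ shared = κ ∘ pair , δ-proper (G □ H) (κ ∘ pair) λ u v same →
  Sum.map (remQuot-injective (order H))
          (subst₂ (Separated (G □ H)) (vertex u) (vertex v))
          (shared (pair u) (pair v) same)
  where
  pair : Fin (order G * order H) → Fin (order G) × Fin (order H)
  pair = remQuot (order H)
  vertex : ∀ u → uncurry combine (pair u) ≡ u
  vertex = combine-remQuot {order G} (order H)

S1-loopless : ∀ k → Loopless (S1 k)
S1-loopless k zero    = refl
S1-loopless k (suc _) = refl

S1-undirected : ∀ k → Undirected (S1 k)
S1-undirected k zero    zero    = refl
S1-undirected k zero    (suc _) = refl
S1-undirected k (suc _) zero    = refl
S1-undirected k (suc _) (suc _) = refl

starDeg : ∀ {k} → Fin (suc k) → ℕ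
starDeg {k} zero = k
starDeg     (suc _) = 1

deg-S1 : ∀ {k} (y : Fin (suc k)) → deg (S1 k) y ≡ starDeg y
deg-S1 {k} zero    = trans (deg≡∑ (S1 k) zero) (∑-one k)
deg-S1 {k} (suc y) = trans (deg≡∑ (S1 k) (suc y)) (cong suc (sum-replicate-zero k))

module StarProduct (m n : ℕ) where

  G : Graph
  G = S1 m □ S1 n

  deg-vertex : ∀ x y → deg G (combine x y) ≡ starDeg y + starDeg x
  deg-vertex x y = trans (deg-□ (S1 m) (S1 n) (S1-loopless m) x y) (cong₂ _+_ (deg-S1 y) (deg-S1 x))

  G-undirected : Undirected G
  G-undirected = □-undirected (S1 m) (S1 n) (S1-undirected m) (S1-undirected n)

  leafVertex : Fin m × Fin n → Fin (order G)
  leafVertex (a , b) = combine (suc a) (suc b)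

  leafVertex-injective : ∀ {c c'} → leafVertex c ≡ leafVertex c' → c ≡ c'
  leafVertex-injective {a , b} {a' , b'} e with combine-injective (suc a) (suc b) (suc a') (suc b') e
  ... | refl , refl = refl

  leafVertex-deg : ∀ c → deg G (leafVertex c) ≡ 2
  leafVertex-deg (a , b) = deg-vertex (suc a) (suc b)

  leafVertex-nonadjacent : ∀ c c' → adj G (leafVertex c) (leafVertex c') ≡ false
  leafVertex-nonadjacent (a , b) (a' , b') rewrite □-adj (S1 m) (S1 n) (suc a) (suc a') (suc b) (suc b')
    = cong₂ _∨_ (∧-zeroʳ (suc a == suc a')) (∧-zeroʳ (suc b == suc b'))

  leafVertex-δ-adjacent : ∀ {c c'} → c ≢ c' → adj (δ-complement G) (leafVertex c) (leafVertex c') ≡ true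
  leafVertex-δ-adjacent {c} {c'} c≢c' =
    trans (δ-complement-adj-≡deg G (c≢c' ∘ leafVertex-injective)
                                   (trans (leafVertex-deg c) (sym (leafVertex-deg c'))))
          (cong not (leafVertex-nonadjacent c c'))

  δ-chromatic-lower-bound : ∀ {j} → j < m * n → ¬ Colourable (δ-complement G) j
  δ-chromatic-lower-bound = clique⇒¬colourable (δ-complement G) (leafVertex ∘ remQuot n)
    λ i≢j → leafVertex-δ-adjacent (i≢j ∘ remQuot-injective n)

module StarColouring (p q : ℕ) where

  private
    M N : ℕ
    M = suc (suc (suc p))
    N = suc (suc (suc q))

  open StarProduct M N

  Axis : Set
  Axis = Fin (suc N) ⊎ Fin M

  axisVertex : Axis → Fin (suc M) × Fin (suc N)
  axisVertex (inj₁ y) = zero , y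
  axisVertex (inj₂ a) = suc a , zero

  -- The colour (a , b) is that of the leaf–leaf vertex leafVertex (a , b).  The vertex (0 , suc b)
  -- must avoid leaf column b and (suc a , 0) leaf row a: shift columns down cyclically along the first
  -- axis (in leaf row 0) and rows along the second (in the last leaf column), moving the two
  -- wrap-around values and the centre to spare cells.
  axisColour : Axis → Fin M × Fin N
  axisColour (inj₁ zero)          = suc zero , suc zero
  axisColour (inj₁ (suc zero))    = fromℕ _ , fromℕ _
  axisColour (inj₁ (suc (suc j))) = zero , inject₁ j
  axisColour (inj₂ zero)          = fromℕ _ , zero
  axisColour (inj₂ (suc i))       = inject₁ i , fromℕ _

  axisColour-injective : ∀ w w' → axisColour w ≡ axisColour w' → w ≡ w'
  axisColour-injective (inj₁ zero)          (inj₁ zero)           _ = refl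
  axisColour-injective (inj₁ zero)          (inj₁ (suc zero))     ()
  axisColour-injective (inj₁ zero)          (inj₁ (suc (suc _)))  ()
  axisColour-injective (inj₁ zero)          (inj₂ zero)           ()
  axisColour-injective (inj₁ zero)          (inj₂ (suc _))        ()
  axisColour-injective (inj₁ (suc zero))    (inj₁ zero)           ()
  axisColour-injective (inj₁ (suc zero))    (inj₁ (suc zero))     _ = refl
  axisColour-injective (inj₁ (suc zero))    (inj₁ (suc (suc _)))  ()
  axisColour-injective (inj₁ (suc zero))    (inj₂ zero)           ()
  axisColour-injective (inj₁ (suc zero))    (inj₂ (suc _))        e = contradiction (,-injectiveˡ e) fromℕ≢inject₁
  axisColour-injective (inj₁ (suc (suc _))) (inj₁ zero)           ()
  axisColour-injective (inj₁ (suc (suc _))) (inj₁ (suc zero))     ()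
  axisColour-injective (inj₁ (suc (suc _))) (inj₁ (suc (suc _)))  e =
    cong (inj₁ ∘ Fin.suc ∘ Fin.suc) (inject₁-injective (,-injectiveʳ e))
  axisColour-injective (inj₁ (suc (suc _))) (inj₂ zero)           ()
  axisColour-injective (inj₁ (suc (suc _))) (inj₂ (suc _))        e = contradiction (sym (,-injectiveʳ e)) fromℕ≢inject₁
  axisColour-injective (inj₂ zero)          (inj₁ zero)           ()
  axisColour-injective (inj₂ zero)          (inj₁ (suc zero))     ()
  axisColour-injective (inj₂ zero)          (inj₁ (suc (suc _)))  ()
  axisColour-injective (inj₂ zero)          (inj₂ zero)           _ = refl
  axisColour-injective (inj₂ zero)          (inj₂ (suc _))        ()
  axisColour-injective (inj₂ (suc _))       (inj₁ zero)           ()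
  axisColour-injective (inj₂ (suc _))       (inj₁ (suc zero))     e = contradiction (sym (,-injectiveˡ e)) fromℕ≢inject₁
  axisColour-injective (inj₂ (suc _))       (inj₁ (suc (suc _)))  e = contradiction (,-injectiveʳ e) fromℕ≢inject₁
  axisColour-injective (inj₂ (suc _))       (inj₂ zero)           ()
  axisColour-injective (inj₂ (suc _))       (inj₂ (suc _))        e = cong (inj₂ ∘ Fin.suc) (inject₁-injective (,-injectiveˡ e))

  axisColour-nonadjacent : ∀ w → adj G (uncurry combine (axisVertex w)) (leafVertex (axisColour w)) ≡ false
  axisColour-nonadjacent (inj₁ zero)          = □-adj (S1 M) (S1 N) zero (suc (suc zero)) zero (suc (suc zero))
  axisColour-nonadjacent (inj₁ (suc zero))    = □-adj (S1 M) (S1 N) zero (fromℕ _) (suc zero) (fromℕ _)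
  axisColour-nonadjacent (inj₁ (suc (suc j))) =
    trans (□-adj (S1 M) (S1 N) zero (suc zero) (suc (suc j)) (suc (inject₁ j)))
          (cong (_∧ true) (==-false (inject₁≢suc j ∘ sym ∘ suc-injective)))
  axisColour-nonadjacent (inj₂ zero)          = □-adj (S1 M) (S1 N) (suc zero) (fromℕ _) zero (suc zero)
  axisColour-nonadjacent (inj₂ (suc i)) =
    trans (□-adj (S1 M) (S1 N) (suc (suc i)) (suc (inject₁ i)) zero (fromℕ _))
          (cong (λ b → (b ∧ true) ∨ false) (==-false (inject₁≢suc i ∘ sym ∘ suc-injective)))

  axisVertex-deg≢2 : ∀ w → deg G (uncurry combine (axisVertex w)) ≢ 2
  axisVertex-deg≢2 (inj₁ zero)    e = contradiction (trans (sym (deg-vertex zero zero)) e) λ ()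
  axisVertex-deg≢2 (inj₁ (suc y)) e = contradiction (trans (sym (deg-vertex zero (suc y))) e) λ ()
  axisVertex-deg≢2 (inj₂ a)       e = contradiction (trans (sym (deg-vertex (suc a) zero)) e) λ ()

  axisColour-separated : ∀ w {c} → axisColour w ≡ c → Separated G (uncurry combine (axisVertex w)) (leafVertex c)
  axisColour-separated w refl =
    (λ e → axisVertex-deg≢2 w (trans e (leafVertex-deg (axisColour w)))) , axisColour-nonadjacent w

  colour : Fin (suc M) × Fin (suc N) → Fin M × Fin N
  colour (suc a , suc b) = a , b
  colour (zero  , y)     = axisColour (inj₁ y)
  colour (suc a , zero)  = axisColour (inj₂ a)

  colour-axisVertex : ∀ w → colour (axisVertex w) ≡ axisColour w
  colour-axisVertex (inj₁ _) = refl
  colour-axisVertex (inj₂ _) = refl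

  data Position : Fin (suc M) × Fin (suc N) → Set where
    leaf : ∀ a b → Position (suc a , suc b)
    axis : ∀ w → Position (axisVertex w)

  position : ∀ u → Position u
  position (zero  , y)     = axis (inj₁ y)
  position (suc a , zero)  = axis (inj₂ a)
  position (suc a , suc b) = leaf a b

  colour-shared : ∀ u v → colour u ≡ colour v → u ≡ v ⊎ Separated G (uncurry combine u) (uncurry combine v)
  colour-shared u v same with position u | position v
  ... | leaf _ _ | leaf _ _ = inj₁ (cong (Product.map Fin.suc Fin.suc) same)
  ... | axis w   | axis w'  =
    inj₁ (cong axisVertex (axisColour-injective w w'
                             (trans (sym (colour-axisVertex w)) (trans same (colour-axisVertex w')))))
  ... | axis w   | leaf _ _ = inj₂ (axisColour-separated w (trans (sym (colour-axisVertex w)) same))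
  ... | leaf a b | axis w   =
    inj₂ (Separated-sym G G-undirected {uncurry combine (axisVertex w)} {leafVertex (a , b)}
                        (axisColour-separated w (trans (sym (colour-axisVertex w)) (sym same))))

  δ-colourable : Colourable (δ-complement G) (M * N)
  δ-colourable = □-δ-colourable (S1 M) (S1 N) (uncurry combine ∘ colour) λ u v same →
    colour-shared u v (×-≡,≡→≡ (combine-injective _ _ _ _ same))

mainTheorem11 : ∀ (m n : ℕ) → 3 ≤ m → 3 ≤ n → δChromaticNumber (S1 m □ S1 n) (m * n)
mainTheorem11 m@(suc (suc (suc p))) n@(suc (suc (suc q))) (s≤s (s≤s (s≤s _))) (s≤s (s≤s (s≤s _))) =
  StarColouring.δ-colourable p q , λ _ → StarProduct.δ-chromatic-lower-bound m n
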